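{- For all integers $n\geqslant 0$ and $k\geqslant 1$, $$(-1)^{k-1} \left( \sum_{j=1}^{k} (-1)^{j-1} p\big(n-3j(j+1)/2\big) - ge(n) \right) \geqslant 0,$$ with strict inequality if $n\geqslant 3(k+1)(k+2)/2$. For example, $p(n-3)\geqslant ge(n)$, $p(n-3)-p(n-9)\leqslant ge(n)$, $p(n-3)-p(n-9)+p(n-18)\geqslant ge(n)$, and $p(n-3)-p(n-9)+p(n-18)-p(n-30)\leqslant ge(n)$.
   Context: $p(n)$ denotes the number of partitions of $n$, with $p(0)=1$ and $p(n)=0$ if $n$ is not a non-negative integer. The rank of a partition is its largest part minus its number of parts; $ge(n)$ is the number of partitions of $n$ with rank $\leqslant -2$ (Garden of Eden partitions). -}

module Defs where

open import Data.Nat using (ℕ; zero; suc; _+_; _*_; _∸_; _≤?_; _/_)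
open import Data.Nat.Properties using ()
open import Data.List using (List; []; _∷_; length; map; concatMap; filter; upTo; head)
open import Data.Maybe using (Maybe; just; nothing)
open import Data.Integer as ℤ using (ℤ; +_; _-_)
open import Relation.Nullary using (yes; no)
open import Relation.Binary.PropositionalEquality using (_≡_)

-- A partition is represented as a non-increasing list of positive parts
-- (largest part first).  parts≤ b n = list of all partitions of n with
-- every part ≤ b; each partition appears exactly once.
-- Fuel f ≥ n guarantees termination (each step removes a part ≥ 1).
partsFuel : ℕ → ℕ → ℕ → List (List ℕ)
partsFuel f       b zero    = [] ∷ []
partsFuel zero    b (suc n) = []
partsFuel (suc f) b (suc n) =
  concatMap (λ i → let a = suc i in
                   if-le a b (suc n) (map (a ∷_) (partsFuel f a (suc n ∸ a))))
            (upTo (suc n))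
  where
  if-le : ℕ → ℕ → ℕ → List (List ℕ) → List (List ℕ)
  if-le a b m xs with a ≤? b | a ≤? m
  ... | yes _ | yes _ = xs
  ... | _         | _         = []

partitions : ℕ → List (List ℕ)
partitions n = partsFuel n n n

pℕ : ℕ → ℕ
pℕ n = length (partitions n)

p : ℤ → ℕ
p (+ n)      = pℕ n
p ℤ.-[1+ _ ] = 0

largest : List ℕ → ℕ
largest []      = 0
largest (a ∷ _) = a

rank : List ℕ → ℤ
rank λs = + largest λs - + length λs

ge : ℕ → ℕ
ge n = length (filter (λ λs → rank λs ℤ.≤? ℤ.-[1+ 1 ]) (partitions n))

neg1^ : ℕ → ℤ
neg1^ e = ℤ.-[1+ 0 ] ℤ.^ e

altSum : ℕ → ℕ → ℤ
altSum n zero    = + 0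
altSum n (suc k) =
  altSum n k ℤ.+ neg1^ k ℤ.* (+ p (+ n - + ((3 * (suc k * (suc k + 1))) / 2)))

module Submission where

-- For k ≥ 1 put T j = 3j(j+1)/2 and let G n j count the partitions of
-- n - T j whose rank is at most -(3j+2) (so G n 0 = ge n).  The theorem
-- follows from the identity
--     (-1)^(k-1) (Σ_{j=1}^{k} (-1)^(j-1) p(n - T j) - ge n) = G n k,
-- since the right side is a count, and it is positive once n - T k exceeds
-- 3k+2 (the single column of that height has rank ≤ -(3k+2)).
--
-- The identity telescopes from p(n - T (j+1)) = G n j + G n (j+1), an
-- instance of the recurrence p(N) = #{rank ≤ -(m+3)} + #{partitions of
-- N + (m+1) with rank ≤ -m}.  The recurrence comes from a bijection that
-- removes the first column of the Young diagram and turns its excess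
-- length into a new first part.

open import Defs
open import Data.Nat as ℕ hiding (_<_)
open import Data.Nat.Properties
open import Data.Nat.DivMod using (m*n/n≡m)
open import Data.Nat.ListAction using (sum)
open import Data.Nat.ListAction.Properties using (sum-++)
open import Data.Nat.Tactic.RingSolver using (solve-∀)
import Data.Integer.Tactic.RingSolver as ℤ-Solver
open import Algebra.Properties.CommutativeSemigroup +-commutativeSemigroup using () renaming (xy∙z≈xz∙y to +-right-comm; x∙yz≈y∙xz to +-exchange)
open import Data.Integer as ℤ using (ℤ; +_; -[1+_]; _⊖_; _-_; _<_) renaming (_≤_ to _≤ℤ_; _*_ to _*ℤ_)
import Data.Integer.Properties as ℤ
open import Data.List using (List; []; _∷_; length; map; concat; concatMap; filter; upTo; head; _++_; replicate)
open import Data.List.Properties using (≡-dec; ∷-injectiveʳ; length-map; length-++; length-replicate; filter-none; filter-≐)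
open import Data.List.Membership.Propositional using (_∈_)
open import Data.List.Membership.Propositional.Properties using (∈-concatMap⁺; ∈-concatMap⁻; ∈-map⁺; ∈-map⁻; ∈-upTo⁺; ∈-filter⁺; ∈-filter⁻; ∈-length)
open import Data.List.Membership.Propositional.Properties.WithK using (unique∧set⇒bag)
open import Data.List.Relation.Unary.Any as Any using (here; there)
open import Data.List.Relation.Unary.All as All using ()
import Data.List.Relation.Unary.All.Properties as All
open import Data.List.Relation.Unary.AllPairs as AllPairs using ()
import Data.List.Relation.Unary.AllPairs.Properties as AllPairs
open import Data.List.Relation.Unary.Unique.Propositional using (Unique)
import Data.List.Relation.Unary.Unique.Propositional.Properties as Unique
open import Data.List.Relation.Binary.Disjoint.Propositional using (Disjoint)
open import Data.List.Relation.Binary.BagAndSetEquality using (∼bag⇒↭)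
open import Data.List.Relation.Binary.Permutation.Propositional.Properties using (↭-length)
open import Data.Maybe using (just)
open import Data.Maybe.Properties using (just-injective)
open import Data.Product using (∃; _×_; _,_; proj₁; proj₂)
open import Data.Empty using (⊥-elim)
open import Function using (_∘_)
open import Function.Bundles using (mk⇔)
open import Relation.Nullary using (yes; no; ¬_; ¬?)
open import Relation.Unary using (Decidable)
open import Relation.Binary.Definitions using (DecidableEquality)
open import Relation.Binary.PropositionalEquality

data Desc : ℕ → List ℕ → Set where
  []   : ∀ {b} → Desc b []
  cons : ∀ {a b xs} → 1 ≤ a → a ≤ b → Desc a xs → Desc b (a ∷ xs)

firstPart : ℕ → ℕ → ℕ → ℕ → List (List ℕ)
firstPart f b n i with suc i ≤? b | suc i ≤? suc n
... | yes _ | yes _ = map (suc i ∷_) (partsFuel f (suc i) (n ∸ i))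
... | _     | _     = []

map-≢⇒witness : ∀ {A B : Set} → DecidableEquality B → {g h : A → B} (xs : List A) →
                map g xs ≢ map h xs → ∃ λ x → g x ≢ h x
map-≢⇒witness _≟_ [] ne = ⊥-elim (ne refl)
map-≢⇒witness _≟_ {g} {h} (x ∷ xs) ne with g x ≟ h x
... | no gx≢hx = x , gx≢hx
... | yes gx≡hx = map-≢⇒witness _≟_ xs (ne ∘ cong₂ _∷_ gx≡hx)

-- Defs selects the branches through
-- an unnamed local helper, so agreement with firstPart is established by
-- refuting a hypothetical point of disagreement.
partsFuel-unfold : ∀ f b n → partsFuel (suc f) b (suc n) ≡ concatMap (firstPart f b n) (upTo (suc n))
partsFuel-unfold f b n with ≡-dec (≡-dec _≟_) (partsFuel (suc f) b (suc n)) (concatMap (firstPart f b n) (upTo (suc n)))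
... | yes eq = eq
... | no ne with map-≢⇒witness (≡-dec (≡-dec _≟_)) (upTo (suc n)) (ne ∘ cong concat)
... | i , differ with suc i ≤? b | suc i ≤? suc n
...   | yes _ | yes _ = ⊥-elim (differ refl)
...   | yes _ | no _  = ⊥-elim (differ refl)
...   | no _  | _     = ⊥-elim (differ refl)

partsFuel-sound : ∀ f b n {xs} → xs ∈ partsFuel f b n → Desc b xs × sum xs ≡ n
partsFuel-sound f       b zero    (here refl) = [] , refl
partsFuel-sound (suc f) b (suc n) {xs} mem
  with i , xs∈branch ← Any.satisfied (∈-concatMap⁻ (firstPart f b n) {xs = upTo (suc n)} (subst (xs ∈_) (partsFuel-unfold f b n) mem))
  with suc i ≤? b | suc i ≤? suc n
... | yes i<b | yes i≤n with ys , ys∈ , refl ← ∈-map⁻ (suc i ∷_) xs∈branch =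
  let desc , sum≡ = partsFuel-sound f (suc i) (n ∸ i) ys∈
  in cons (s≤s z≤n) i<b desc , cong suc (trans (cong (i ℕ.+_) sum≡) (m+[n∸m]≡n (≤-pred i≤n)))
... | yes _ | no _ with () ← xs∈branch
... | no _  | _    with () ← xs∈branch

partsFuel-complete : ∀ f b {n xs} → Desc b xs → sum xs ≡ n → n ≤ f → xs ∈ partsFuel f b n
partsFuel-complete f       b [] refl _ = here refl
partsFuel-complete (suc f) b {xs = suc i ∷ ys} (cons _ i<b desc) refl (s≤s n≤f) =
  subst (suc i ∷ ys ∈_) (sym (partsFuel-unfold f b (i + sum ys)))
        (∈-concatMap⁺ (firstPart f b (i + sum ys)) (Any.map (λ { refl → in-branch }) (∈-upTo⁺ (s≤s (m≤m+n i (sum ys))))))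
  where
  rest≡ : i + sum ys ∸ i ≡ sum ys
  rest≡ = m+n∸m≡n i (sum ys)
  in-branch : suc i ∷ ys ∈ firstPart f b (i + sum ys) i
  in-branch with suc i ≤? b | suc i ≤? suc (i + sum ys)
  ... | yes _ | yes _ = ∈-map⁺ (suc i ∷_)
        (partsFuel-complete f (suc i) desc (sym rest≡) (subst (_≤ f) (sym rest≡) (≤-trans (m≤n+m (sum ys) i) n≤f)))
  ... | no i≮b | _      = ⊥-elim (i≮b i<b)
  ... | yes _  | no i≰n = ⊥-elim (i≰n (s≤s (m≤m+n i (sum ys))))

-- Each partition is listed exactly once: the branches are duplicate-free by
-- induction and pairwise disjoint because they differ in the first part.
partsFuel-unique : ∀ f b n → Unique (partsFuel f b n)
partsFuel-unique f       b zero    = All.[] AllPairs.∷ AllPairs.[]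
partsFuel-unique zero    b (suc n) = AllPairs.[]
partsFuel-unique (suc f) b (suc n) = subst Unique (sym (partsFuel-unfold f b n))
  (Unique.concat⁺ (All.map⁺ (All.universal branch-unique (upTo (suc n))))
                  (AllPairs.map⁺ (AllPairs.map branches-disjoint (Unique.upTo⁺ (suc n)))))
  where
  branch-unique : ∀ i → Unique (firstPart f b n i)
  branch-unique i with suc i ≤? b | suc i ≤? suc n
  ... | yes _ | yes _ = Unique.map⁺ ∷-injectiveʳ (partsFuel-unique f (suc i) (n ∸ i))
  ... | yes _ | no _  = AllPairs.[]
  ... | no _  | _     = AllPairs.[]
  branch-head : ∀ i {ys} → ys ∈ firstPart f b n i → head ys ≡ just (suc i)
  branch-head i mem with suc i ≤? b | suc i ≤? suc n
  ... | yes _ | yes _ with _ , _ , refl ← ∈-map⁻ (suc i ∷_) mem = refl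
  branch-head i () | yes _ | no _
  branch-head i () | no _  | _
  branches-disjoint : ∀ {i j} → i ≢ j → Disjoint (firstPart f b n i) (firstPart f b n j)
  branches-disjoint i≢j (mi , mj) = i≢j (suc-injective (just-injective (trans (sym (branch-head _ mi)) (branch-head _ mj))))

largest≤bound : ∀ {b xs} → Desc b xs → largest xs ≤ b
largest≤bound []           = z≤n
largest≤bound (cons _ a≤b _) = a≤b

Desc-weaken : ∀ {a b xs} → a ≤ b → Desc a xs → Desc b xs
Desc-weaken _   []               = []
Desc-weaken a≤b (cons p q desc) = cons p (≤-trans q a≤b) desc

Desc-largest : ∀ {b xs} → Desc b xs → Desc (largest xs) xs
Desc-largest []              = []
Desc-largest (cons p _ desc) = cons p ≤-refl desc

largest≤sum : ∀ {b xs} → Desc b xs → largest xs ≤ sum xs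
largest≤sum []                      = z≤n
largest≤sum {xs = a ∷ xs} (cons _ _ _) = m≤m+n a (sum xs)

length≤sum : ∀ {b xs} → Desc b xs → length xs ≤ sum xs
length≤sum []               = z≤n
length≤sum (cons 1≤a _ desc) = +-mono-≤ 1≤a (length≤sum desc)

partition-sound : ∀ {n xs} → xs ∈ partitions n → Desc n xs × sum xs ≡ n
partition-sound {n} = partsFuel-sound n n n

partition-complete : ∀ {b n xs} → Desc b xs → sum xs ≡ n → xs ∈ partitions n
partition-complete {n = n} desc refl =
  partsFuel-complete n n (Desc-weaken (largest≤sum desc) (Desc-largest desc)) refl ≤-refl

partitions-unique : ∀ n → Unique (partitions n)
partitions-unique n = partsFuel-unique n n n

map-unique : ∀ {A B : Set} (f : A → B) (g : B → A) {xs : List A} → Unique xs →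
             (∀ {x} → x ∈ xs → g (f x) ≡ x) → Unique (map f xs)
map-unique f g AllPairs.[]          _   = AllPairs.[]
map-unique f g (x∉xs AllPairs.∷ u) inv =
  All.map⁺ (All.tabulate λ y∈xs fx≡fy →
    All.lookup x∉xs y∈xs (trans (sym (inv (here refl))) (trans (cong g fx≡fy) (inv (there y∈xs)))))
  AllPairs.∷ map-unique f g u (inv ∘ there)

count-bijection : ∀ {A B : Set} {P : A → Set} {Q : B → Set} (P? : Decidable P) (Q? : Decidable Q)
  {xs : List A} {ys : List B} → Unique xs → Unique ys → (f : A → B) (g : B → A) →
  (∀ {x} → x ∈ xs → P x → f x ∈ ys × Q (f x) × g (f x) ≡ x) →
  (∀ {y} → y ∈ ys → Q y → g y ∈ xs × P (g y) × f (g y) ≡ y) →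
  length (filter P? xs) ≡ length (filter Q? ys)
count-bijection {P = P} {Q} P? Q? {xs} {ys} uxs uys f g forth back =
  trans (sym (length-map f (filter P? xs)))
        (↭-length (∼bag⇒↭ (unique∧set⇒bag image-unique (Unique.filter⁺ Q? uys) (mk⇔ to from))))
  where
  image-unique : Unique (map f (filter P? xs))
  image-unique = map-unique f g (Unique.filter⁺ P? uxs)
    (λ x∈ → let x∈xs , px = ∈-filter⁻ P? x∈ in proj₂ (proj₂ (forth x∈xs px)))
  to : ∀ {z} → z ∈ map f (filter P? xs) → z ∈ filter Q? ys
  to z∈ with x , x∈ , refl ← ∈-map⁻ f z∈ =
    let x∈xs , px = ∈-filter⁻ P? x∈ ; fx∈ys , qfx , _ = forth x∈xs px in ∈-filter⁺ Q? fx∈ys qfx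
  from : ∀ {z} → z ∈ filter Q? ys → z ∈ map f (filter P? xs)
  from {z} z∈ = let z∈ys , qz = ∈-filter⁻ Q? z∈ ; gz∈xs , pgz , fgz≡z = back z∈ys qz in
    subst (_∈ map f (filter P? xs)) fgz≡z (∈-map⁺ f (∈-filter⁺ P? gz∈xs pgz))

length-filter-split : ∀ {A : Set} {P : A → Set} (P? : Decidable P) (xs : List A) →
  length xs ≡ length (filter P? xs) + length (filter (¬? ∘ P?) xs)
length-filter-split P? [] = refl
length-filter-split P? (x ∷ xs) with P? x
... | yes _ = cong suc (length-filter-split P? xs)
... | no _  = trans (cong suc (length-filter-split P? xs)) (sym (+-suc _ _))

-- Young-diagram operations on partitions written as non-increasing lists.
-- shrink removes the first column (decrease every part, dropping the 1s);
-- grow adds one cell to every row; ones t is a column of t cells.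
shrink : List ℕ → List ℕ
shrink []                 = []
shrink (zero ∷ _)         = []
shrink (suc zero ∷ _)     = []
shrink (suc (suc a) ∷ xs) = suc a ∷ shrink xs

grow : List ℕ → List ℕ
grow = map suc

ones : ℕ → List ℕ
ones t = replicate t 1

prepend : ℕ → List ℕ → List ℕ
prepend zero    xs = xs
prepend (suc c) xs = suc c ∷ xs

Desc-zero : ∀ {xs} → Desc 0 xs → xs ≡ []
Desc-zero []                 = refl
Desc-zero (cons (s≤s _) () _)

ones-desc : ∀ t → Desc 1 (ones t)
ones-desc zero    = []
ones-desc (suc t) = cons ≤-refl ≤-refl (ones-desc t)

sum-ones : ∀ t → sum (ones t) ≡ t
sum-ones zero    = refl
sum-ones (suc t) = cong suc (sum-ones t)

desc1-ones : ∀ {xs} → Desc 1 xs → xs ≡ ones (length xs)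
desc1-ones []                            = refl
desc1-ones (cons (s≤s z≤n) (s≤s z≤n) desc) = cong (1 ∷_) (desc1-ones desc)

column-decomposition : ∀ {b xs} → Desc b xs → xs ≡ grow (shrink xs) ++ ones (length xs ∸ length (shrink xs))
column-decomposition []                                = refl
column-decomposition (cons {suc zero}    _ _ desc) = cong (1 ∷_) (desc1-ones desc)
column-decomposition (cons {suc (suc a)} _ _ desc) = cong (suc (suc a) ∷_) (column-decomposition desc)

sum-shrink : ∀ {b xs} → Desc b xs → sum xs ≡ length xs + sum (shrink xs)
sum-shrink [] = refl
sum-shrink {xs = _ ∷ xs} (cons {suc zero} _ _ desc) =
  cong suc (trans (cong sum (desc1-ones desc)) (trans (sum-ones (length xs)) (sym (+-identityʳ _))))
sum-shrink {xs = _ ∷ xs} (cons {suc (suc a)} _ _ desc) =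
  cong suc (trans (cong (suc a ℕ.+_) (sum-shrink desc)) (+-exchange (suc a) (length xs) (sum (shrink xs))))

length-shrink : ∀ xs → length (shrink xs) ≤ length xs
length-shrink []                 = z≤n
length-shrink (zero ∷ _)         = z≤n
length-shrink (suc zero ∷ _)     = z≤n
length-shrink (suc (suc a) ∷ xs) = s≤s (length-shrink xs)

Desc-shrink : ∀ {b xs} → Desc b xs → Desc (pred b) (shrink xs)
Desc-shrink []                                  = []
Desc-shrink (cons {suc zero} _ _ _)             = []
Desc-shrink (cons {suc (suc a)} _ (s≤s a<b) desc) = cons (s≤s z≤n) a<b (Desc-shrink desc)

Desc-grow : ∀ {b xs} → Desc b xs → ∀ t → Desc (suc b) (grow xs ++ ones t)
Desc-grow []              t = Desc-weaken (s≤s z≤n) (ones-desc t)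
Desc-grow (cons _ a≤b desc) t = cons (s≤s z≤n) (s≤s a≤b) (Desc-grow desc t)

shrink-grow : ∀ {b xs} → Desc b xs → ∀ t → shrink (grow xs ++ ones t) ≡ xs
shrink-grow []                       zero    = refl
shrink-grow []                       (suc t) = refl
shrink-grow (cons {suc a} _ _ desc) t = cong (suc a ∷_) (shrink-grow desc t)

sum-grow : ∀ xs t → sum (grow xs ++ ones t) ≡ length xs + sum xs + t
sum-grow xs t = begin
  sum (grow xs ++ ones t)           ≡⟨ sum-++ (grow xs) (ones t) ⟩
  sum (grow xs) + sum (ones t)      ≡⟨ cong₂ _+_ (sum-map-suc xs) (sum-ones t) ⟩
  length xs + sum xs + t            ∎
  where
  open ≡-Reasoning
  sum-map-suc : ∀ xs → sum (map suc xs) ≡ length xs + sum xs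
  sum-map-suc []       = refl
  sum-map-suc (x ∷ xs) = cong suc (trans (cong (x ℕ.+_) (sum-map-suc xs)) (+-exchange x (length xs) (sum xs)))

length-grow : ∀ xs t → length (grow xs ++ ones t) ≡ length xs + t
length-grow xs t = trans (length-++ (grow xs)) (cong₂ _+_ (length-map suc xs) (length-replicate t))

-- LowRank m xs : the rank of xs is at most -m.
LowRank : ℕ → List ℕ → Set
LowRank m xs = m + largest xs ≤ length xs

lowRank? : ∀ m → Decidable (LowRank m)
lowRank? m xs = m + largest xs ≤? length xs

lowRankCount : ℕ → ℕ → ℕ
lowRankCount m N = length (filter (lowRank? m) (partitions N))

-- A partition of N + (m+1) of rank ≤ -m
-- with ℓ = c + (m+1) parts loses its first column and gains a first part c;
-- conversely a partition (c, rest) of N of rank > -(m+3) gets one cell added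
-- to each part of rest and a first column of height c + (m+1).
stripColumn : ℕ → List ℕ → List ℕ
stripColumn m xs = prepend (length xs ∸ suc m) (shrink xs)

addColumn : ℕ → List ℕ → List ℕ
addColumn m []         = ones (suc m)
addColumn m (c ∷ rest) = grow rest ++ ones (c + suc m ∸ length rest)

prepend-desc : ∀ {c r} → Desc c r → Desc c (prepend c r)
prepend-desc {zero}  desc = desc
prepend-desc {suc c} desc = cons (s≤s z≤n) ≤-refl desc

sum-prepend : ∀ c r → sum (prepend c r) ≡ c + sum r
sum-prepend zero    r = refl
sum-prepend (suc c) r = refl

length-prepend : ∀ c r → length (prepend c r) ≤ suc (length r)
length-prepend zero    r = n≤1+n (length r)
length-prepend (suc c) r = ≤-refl

largest-prepend : ∀ {c r} → Desc c r → largest (prepend c r) ≡ c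
largest-prepend {zero}  desc rewrite Desc-zero desc = refl
largest-prepend {suc c} desc = refl

prepend-positive : ∀ {c} r → 1 ≤ c → prepend c r ≡ c ∷ r
prepend-positive r (s≤s z≤n) = refl

addColumn-prepend : ∀ m {c r} → Desc c r → addColumn m (prepend c r) ≡ grow r ++ ones (c + suc m ∸ length r)
addColumn-prepend m {zero}  desc rewrite Desc-zero desc = refl
addColumn-prepend m {suc c} desc = refl

lowRank-column : ∀ {b a xs} m → Desc b (a ∷ xs) → LowRank m (a ∷ xs) →
  let c = length (a ∷ xs) ∸ suc m in c + suc m ≡ length (a ∷ xs) × Desc c (shrink (a ∷ xs))
lowRank-column {a = a} {xs} m desc@(cons 1≤a _ _) low = length≡ , Desc-weaken (pred-mono-≤ a≤1+c) (Desc-shrink (Desc-largest desc))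
  where
  ℓ = length (a ∷ xs)
  c = ℓ ∸ suc m
  length≡ : c + suc m ≡ ℓ
  length≡ = m∸n+n≡m (≤-trans (≤-reflexive (+-comm 1 m)) (≤-trans (+-monoʳ-≤ m 1≤a) low))
  a≤1+c : a ≤ suc c
  a≤1+c = +-cancelˡ-≤ m a (suc c) (≤-trans low (≤-reflexive (trans (sym length≡) (trans (+-comm c (suc m)) (sym (+-suc m c))))))

strip-column : ∀ m N {x} → x ∈ partitions (N + suc m) → LowRank m x →
  stripColumn m x ∈ partitions N × ¬ LowRank (3 + m) (stripColumn m x) × addColumn m (stripColumn m x) ≡ x
strip-column m N {x} x∈ low with partition-sound {N + suc m} x∈
strip-column m N {[]}     x∈ low | _ , sum≡ = ⊥-elim (m+1+n≢0 N {m} (sym sum≡))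
strip-column m N {a ∷ xs} x∈ low | desc , sum≡ =
  partition-complete (prepend-desc rest-desc) sum-strip , high-rank , restore
  where
  ℓ = length (a ∷ xs)
  c = ℓ ∸ suc m
  r = shrink (a ∷ xs)
  length≡ : c + suc m ≡ ℓ
  length≡ = proj₁ (lowRank-column m desc low)
  rest-desc : Desc c r
  rest-desc = proj₂ (lowRank-column m desc low)
  sum-strip : sum (prepend c r) ≡ N
  sum-strip = +-cancelʳ-≡ (suc m) _ _ (begin
    sum (prepend c r) + suc m ≡⟨ cong (_+ suc m) (sum-prepend c r) ⟩
    c + sum r + suc m         ≡⟨ +-right-comm c (sum r) (suc m) ⟩
    c + suc m + sum r         ≡⟨ cong (_+ sum r) length≡ ⟩
    ℓ + sum r                 ≡⟨ sym (sum-shrink desc) ⟩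
    sum (a ∷ xs)              ≡⟨ sum≡ ⟩
    N + suc m                 ∎)
    where open ≡-Reasoning
  high-rank : ¬ LowRank (3 + m) (prepend c r)
  high-rank too-low = n≮n (suc (c + suc m)) (begin-strict
    suc (c + suc m)                   <⟨ ≤-reflexive (cong (2 ℕ.+_) (trans (+-suc c m) (cong suc (+-comm c m)))) ⟩
    3 + m + c                         ≡⟨ cong (3 + m ℕ.+_) (sym (largest-prepend rest-desc)) ⟩
    3 + m + largest (prepend c r)     ≤⟨ too-low ⟩
    length (prepend c r)              ≤⟨ length-prepend c r ⟩
    suc (length r)                    ≤⟨ s≤s (length-shrink (a ∷ xs)) ⟩
    suc ℓ                             ≡⟨ cong suc (sym length≡) ⟩
    suc (c + suc m)                   ∎)
    where open ≤-Reasoning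
  restore : addColumn m (prepend c r) ≡ a ∷ xs
  restore = begin
    addColumn m (prepend c r)         ≡⟨ addColumn-prepend m rest-desc ⟩
    grow r ++ ones (c + suc m ∸ length r) ≡⟨ cong (λ k → grow r ++ ones (k ∸ length r)) length≡ ⟩
    grow r ++ ones (ℓ ∸ length r)     ≡⟨ sym (column-decomposition desc) ⟩
    a ∷ xs                            ∎
    where open ≡-Reasoning

add-column : ∀ m N {y} → y ∈ partitions N → ¬ LowRank (3 + m) y →
  addColumn m y ∈ partitions (N + suc m) × LowRank m (addColumn m y) × stripColumn m (addColumn m y) ≡ y
add-column m N {y} y∈ high with partition-sound {N} y∈
add-column m .0 {[]} y∈ high | _ , refl =
  partition-complete (ones-desc (suc m)) (sum-ones (suc m)) , column-low , cong (λ k → prepend k []) column-excess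
  where
  column-low : LowRank m (ones (suc m))
  column-low = subst (m + 1 ≤_) (sym (length-replicate (suc m))) (≤-reflexive (+-comm m 1))
  column-excess : length (ones (suc m)) ∸ suc m ≡ 0
  column-excess = trans (cong (_∸ suc m) (length-replicate (suc m))) (n∸n≡0 (suc m))
add-column m N {c ∷ rest} y∈ high | cons 1≤c _ rest-desc , sum≡ =
  partition-complete (Desc-grow rest-desc t) sum-add , low , restore
  where
  c+1+m≡ : suc (m + c) ≡ c + suc m
  c+1+m≡ = trans (cong suc (+-comm m c)) (sym (+-suc c m))
  t = c + suc m ∸ length rest
  length≡ : length rest + t ≡ c + suc m
  length≡ = m+[n∸m]≡n (subst (length rest ≤_) c+1+m≡ (≤-pred (≤-pred (≰⇒> high))))
  length-add : length (grow rest ++ ones t) ≡ c + suc m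
  length-add = trans (length-grow rest t) length≡
  sum-add : sum (grow rest ++ ones t) ≡ N + suc m
  sum-add = begin
    sum (grow rest ++ ones t)   ≡⟨ sum-grow rest t ⟩
    length rest + sum rest + t  ≡⟨ +-right-comm (length rest) (sum rest) t ⟩
    length rest + t + sum rest  ≡⟨ cong (_+ sum rest) length≡ ⟩
    c + suc m + sum rest        ≡⟨ +-right-comm c (suc m) (sum rest) ⟩
    c + sum rest + suc m        ≡⟨ cong (_+ suc m) sum≡ ⟩
    N + suc m                   ∎
    where open ≡-Reasoning
  low : LowRank m (grow rest ++ ones t)
  low = subst (m + largest (grow rest ++ ones t) ≤_) (sym length-add)
          (≤-trans (+-monoʳ-≤ m (largest≤bound (Desc-grow rest-desc t))) (≤-reflexive (trans (+-suc m c) c+1+m≡)))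
  restore : stripColumn m (grow rest ++ ones t) ≡ c ∷ rest
  restore = trans (cong₂ prepend (trans (cong (_∸ suc m) length-add) (m+n∸n≡m c (suc m))) (shrink-grow rest-desc t))
                  (prepend-positive rest 1≤c)

-- Removing the first column is a bijection between partitions of N + (m+1)
-- of rank ≤ -m and partitions of N of rank > -(m+3); hence
-- p(N) = #{rank ≤ -(m+3)} + #{partitions of N + (m+1) of rank ≤ -m}.
lowRank-recurrence : ∀ m N → pℕ N ≡ lowRankCount (3 + m) N + lowRankCount m (N + suc m)
lowRank-recurrence m N = trans (length-filter-split (lowRank? (3 + m)) (partitions N))
  (cong (lowRankCount (3 + m) N ℕ.+_) (sym
    (count-bijection (lowRank? m) (¬? ∘ lowRank? (3 + m)) (partitions-unique (N + suc m)) (partitions-unique N)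
                     (stripColumn m) (addColumn m) (strip-column m N) (add-column m N))))

lowRankCount-vanishes : ∀ {m N} → 1 ≤ m → N ≤ m → lowRankCount m N ≡ 0
lowRankCount-vanishes {m} {N} 1≤m N≤m = cong length (filter-none (lowRank? m) (All.tabulate not-low))
  where
  not-low : ∀ {x} → x ∈ partitions N → ¬ LowRank m x
  not-low {x} x∈ low with partition-sound {N} x∈
  not-low {[]}    x∈ low | _ , _ = <⇒≱ 1≤m (subst (_≤ 0) (+-identityʳ m) low)
  not-low {a ∷ xs} x∈ low | desc@(cons 1≤a _ _) , sum≡ =
    <⇒≱ (≤-trans (≤-reflexive (+-comm 1 m)) (+-monoʳ-≤ m 1≤a))
        (≤-trans low (≤-trans (length≤sum desc) (≤-trans (≤-reflexive sum≡) N≤m)))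

-- For N ≥ m + 1 the single column of height N has rank ≤ -m.
lowRankCount-positive : ∀ {m N} → suc m ≤ N → 1 ≤ lowRankCount m N
lowRankCount-positive {m} {suc N} m<N = ∈-length (∈-filter⁺ (lowRank? m)
  (partition-complete (ones-desc (suc N)) (sum-ones (suc N)))
  (subst₂ _≤_ (+-comm 1 m) (sym (length-replicate (suc N))) m<N))

⊖≤-2⇒ : ∀ a b → a ⊖ b ℤ.≤ -[1+ 1 ] → 2 + a ≤ b
⊖≤-2⇒ zero    (suc (suc b)) _ = s≤s (s≤s z≤n)
⊖≤-2⇒ zero    (suc zero)    (ℤ.-≤- ())
⊖≤-2⇒ (suc a) (suc b) le = s≤s (⊖≤-2⇒ a b (subst (ℤ._≤ -[1+ 1 ]) (ℤ.[1+m]⊖[1+n]≡m⊖n a b) le))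
⊖≤-2⇒ _       zero    ()

⇒⊖≤-2 : ∀ a b → 2 + a ≤ b → a ⊖ b ℤ.≤ -[1+ 1 ]
⇒⊖≤-2 zero    (suc (suc b)) _         = ℤ.-≤- (s≤s z≤n)
⇒⊖≤-2 zero    (suc zero)    (s≤s ())
⇒⊖≤-2 (suc a) (suc b)       (s≤s le) = subst (ℤ._≤ -[1+ 1 ]) (sym (ℤ.[1+m]⊖[1+n]≡m⊖n a b)) (⇒⊖≤-2 a b le)

ge≡lowRankCount : ∀ n → ge n ≡ lowRankCount 2 n
ge≡lowRankCount n = cong length (filter-≐ _ (lowRank? 2) ((λ {xs} → to {xs}) , (λ {xs} → from {xs})) (partitions n))
  where
  to : ∀ {xs} → rank xs ℤ.≤ -[1+ 1 ] → LowRank 2 xs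
  to {xs} le = ⊖≤-2⇒ (largest xs) (length xs) (subst (ℤ._≤ -[1+ 1 ]) (ℤ.m-n≡m⊖n (largest xs) (length xs)) le)
  from : ∀ {xs} → LowRank 2 xs → rank xs ℤ.≤ -[1+ 1 ]
  from {xs} le = subst (ℤ._≤ -[1+ 1 ]) (sym (ℤ.m-n≡m⊖n (largest xs) (length xs))) (⇒⊖≤-2 (largest xs) (length xs) le)

T : ℕ → ℕ
T zero    = 0
T (suc j) = T j + 3 * suc j

T-closed-form : ∀ j → (3 * (j * (j + 1))) / 2 ≡ T j
T-closed-form j = trans (cong (_/ 2) (twice j)) (m*n/n≡m (T j) 2)
  where
  step : ∀ j → 3 * (suc j * (suc j + 1)) ≡ 3 * (j * (j + 1)) + 3 * suc j * 2
  step = solve-∀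
  twice : ∀ j → 3 * (j * (j + 1)) ≡ T j * 2
  twice zero    = refl
  twice (suc j) = begin
    3 * (suc j * (suc j + 1))          ≡⟨ step j ⟩
    3 * (j * (j + 1)) + 3 * suc j * 2  ≡⟨ cong (_+ 3 * suc j * 2) (twice j) ⟩
    T j * 2 + 3 * suc j * 2            ≡⟨ sym (*-distribʳ-+ 2 (T j) (3 * suc j)) ⟩
    T (suc j) * 2                      ∎
    where open ≡-Reasoning

lowRankCountℤ : ℕ → ℤ → ℕ
lowRankCountℤ m (+ N)    = lowRankCount m N
lowRankCountℤ m -[1+ _ ] = 0

-- The recurrence holds at every integer point z once m ≥ 1: when
-- z - (m+1) < 0 both sides vanish.
lowRank-recurrenceℤ : ∀ m z → 1 ≤ m → lowRankCountℤ m z + lowRankCountℤ (3 + m) (z - + suc m) ≡ p (z - + suc m)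
lowRank-recurrenceℤ m -[1+ _ ] _ = refl
lowRank-recurrenceℤ m (+ N) 1≤m with suc m ≤? N
... | yes m<N rewrite trans (ℤ.m-n≡m⊖n N (suc m)) (ℤ.≤-⊖ m<N) = begin
  lowRankCount m N + lowRankCount (3 + m) M     ≡⟨ +-comm (lowRankCount m N) _ ⟩
  lowRankCount (3 + m) M + lowRankCount m N     ≡⟨ cong (λ k → lowRankCount (3 + m) M + lowRankCount m k) (sym (m∸n+n≡m m<N)) ⟩
  lowRankCount (3 + m) M + lowRankCount m (M + suc m) ≡⟨ sym (lowRank-recurrence m M) ⟩
  pℕ M                                           ∎
  where
  open ≡-Reasoning
  M = N ∸ suc m
... | no m≮N rewrite trans (ℤ.m-n≡m⊖n N (suc m)) (ℤ.⊖-< (≰⇒> m≮N)) | +-∸-assoc 1 (≤-pred (≰⇒> m≮N)) =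
  trans (+-identityʳ _) (lowRankCount-vanishes 1≤m (≤-pred (≰⇒> m≮N)))

G : ℕ → ℕ → ℕ
G n j = lowRankCountℤ (3 * j + 2) (+ n - + T j)

G-zero : ∀ n → G n 0 ≡ ge n
G-zero n = trans (cong (lowRankCountℤ 2) (ℤ.+-identityʳ (+ n))) (sym (ge≡lowRankCount n))

G-step : ∀ n j → G n j + G n (suc j) ≡ p (+ n - + T (suc j))
G-step n j = begin
  G n j + G n (suc j)                                   ≡⟨ cong₂ (λ k w → G n j + lowRankCountℤ k w) (index≡ j) shift≡ ⟩
  G n j + lowRankCountℤ (3 + m) (z - + suc m)          ≡⟨ lowRank-recurrenceℤ m z (≤-trans (s≤s z≤n) (m≤n+m 2 (3 * j))) ⟩
  p (z - + suc m)                                       ≡⟨ cong p (sym shift≡) ⟩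
  p (+ n - + T (suc j))                                 ∎
  where
  open ≡-Reasoning
  m = 3 * j + 2
  z = + n - + T j
  index≡ : ∀ j → 3 * suc j + 2 ≡ 3 + (3 * j + 2)
  index≡ = solve-∀
  gap≡ : ∀ j → 3 * suc j ≡ suc (3 * j + 2)
  gap≡ = solve-∀
  sub-+ : ∀ (x a b : ℤ) → x - (a ℤ.+ b) ≡ (x - a) - b
  sub-+ = ℤ-Solver.solve-∀
  shift≡ : + n - + T (suc j) ≡ z - + suc m
  shift≡ = trans (sub-+ (+ n) (+ T j) (+ (3 * suc j))) (cong (λ k → z - + k) (gap≡ j))

neg1^-square : ∀ k → neg1^ k *ℤ neg1^ k ≡ + 1
neg1^-square zero    = refl
neg1^-square (suc k) = trans (flip-sign (neg1^ k)) (neg1^-square k)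
  where
  flip-sign : ∀ s → (ℤ.- + 1 *ℤ s) *ℤ (ℤ.- + 1 *ℤ s) ≡ s *ℤ s
  flip-sign = ℤ-Solver.solve-∀

-- Since p(n - T j) = G n (j-1) + G n j, the alternating sum telescopes.
altSum-telescopes : ∀ n k → altSum n k ≡ + G n 0 - neg1^ k *ℤ + G n k
altSum-telescopes n zero    = sym (cancel (+ G n 0))
  where
  cancel : ∀ g → g - + 1 *ℤ g ≡ + 0
  cancel = ℤ-Solver.solve-∀
altSum-telescopes n (suc k) = begin
  altSum n k ℤ.+ s *ℤ + p (+ n - + ((3 * (suc k * (suc k + 1))) / 2))
    ≡⟨ cong₂ (λ a t → a ℤ.+ s *ℤ + p (+ n - + t)) (altSum-telescopes n k) (T-closed-form (suc k)) ⟩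
  (+ G n 0 - s *ℤ + G n k) ℤ.+ s *ℤ + p (+ n - + T (suc k))
    ≡⟨ cong (λ t → (+ G n 0 - s *ℤ + G n k) ℤ.+ s *ℤ + t) (sym (G-step n k)) ⟩
  (+ G n 0 - s *ℤ + G n k) ℤ.+ s *ℤ (+ G n k ℤ.+ + G n (suc k))
    ≡⟨ regroup (+ G n 0) s (+ G n k) (+ G n (suc k)) ⟩
  + G n 0 - neg1^ (suc k) *ℤ + G n (suc k) ∎
  where
  open ≡-Reasoning
  s = neg1^ k
  regroup : ∀ g₀ s gₖ gₖ₊₁ → (g₀ - s *ℤ gₖ) ℤ.+ s *ℤ (gₖ ℤ.+ gₖ₊₁) ≡ g₀ - (ℤ.- + 1 *ℤ s) *ℤ gₖ₊₁
  regroup = ℤ-Solver.solve-∀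

signed-gap : ∀ n k → neg1^ k *ℤ (altSum n (suc k) - + ge n) ≡ + G n (suc k)
signed-gap n k = begin
  s *ℤ (altSum n (suc k) - + ge n)
    ≡⟨ cong₂ (λ a g → s *ℤ (a - + g)) (altSum-telescopes n (suc k)) (sym (G-zero n)) ⟩
  s *ℤ ((+ G n 0 - (ℤ.- + 1 *ℤ s) *ℤ + G n (suc k)) - + G n 0)
    ≡⟨ collapse (+ G n 0) s (+ G n (suc k)) ⟩
  (s *ℤ s) *ℤ + G n (suc k)
    ≡⟨ cong (_*ℤ + G n (suc k)) (neg1^-square k) ⟩
  + 1 *ℤ + G n (suc k)
    ≡⟨ ℤ.*-identityˡ _ ⟩
  + G n (suc k) ∎
  where
  open ≡-Reasoning
  s = neg1^ k
  collapse : ∀ g₀ s g → s *ℤ ((g₀ - (ℤ.- + 1 *ℤ s) *ℤ g) - g₀) ≡ (s *ℤ s) *ℤ g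
  collapse = ℤ-Solver.solve-∀

-- Past the threshold T (k+2), the column of height n - T (k+1) is counted by G n (k+1).
G-positive : ∀ n k → T (suc (suc k)) ≤ n → 1 ≤ G n (suc k)
G-positive n k T≤n = subst (λ z → 1 ≤ lowRankCountℤ (3 * suc k + 2) z) (sym shift≡)
  (lowRankCount-positive (subst (_≤ n ∸ t) (gap≡ k) (subst (_≤ n ∸ t) (m+n∸m≡n t _) (∸-monoˡ-≤ t T≤n))))
  where
  t = T (suc k)
  gap≡ : ∀ k → 3 * suc (suc k) ≡ suc (3 * suc k + 2)
  gap≡ = solve-∀
  shift≡ : + n - + t ≡ + (n ∸ t)
  shift≡ = trans (ℤ.m-n≡m⊖n n t) (ℤ.≤-⊖ (≤-trans (m≤m+n t _) T≤n))

threshold≡ : ∀ k → (3 * ((suc k + 1) * (suc k + 2))) / 2 ≡ T (suc (suc k))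
threshold≡ k = trans (cong (λ w → w / 2) (reindex k)) (T-closed-form (suc (suc k)))
  where
  reindex : ∀ k → 3 * ((suc k + 1) * (suc k + 2)) ≡ 3 * (suc (suc k) * (suc (suc k) + 1))
  reindex = solve-∀

corollary4p4 : (n k : ℕ) → 1 ≤ k →
    (+ 0 ≤ℤ neg1^ (k ∸ 1) *ℤ (altSum n k - + ge n))
    × ((3 * ((k + 1) * (k + 2))) / 2 ≤ n → + 0 < neg1^ (k ∸ 1) *ℤ (altSum n k - + ge n))
corollary4p4 n (suc k) _ =
  subst (+ 0 ≤ℤ_) (sym (signed-gap n k)) (ℤ.+≤+ z≤n) ,
  λ past-threshold → subst (+ 0 <_) (sym (signed-gap n k))
    (ℤ.+<+ (G-positive n k (subst (_≤ n) (threshold≡ k) past-threshold)))
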